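{- Let $G=(V,E)$ be an $\ell$-layered DST instance: a directed graph with nonnegative edge costs $c_e$ ($e\in E$), root $r$, terminals $T$, and a partition $V=V_0\cup V_1\cup\dots\cup V_\ell$ with $V_0=\{r\}$, $V_\ell=T$, and every edge $uv\in E$ satisfying $u\in V_i$, $v\in V_{i+1}$ for some $0\le i<\ell$. Consider the edge formulation (DST-LP2) in variables $y_e$, $e\in E$: \[ \min \sum_{e\in E} c_e y_e \] subject to $\sum_{e\in\delta^{in}(t)} y_e\ge 1$ for all $t\in T$; $\sum_{e\in\delta^{in}(v)} y_e\le 1$ for all $v\in V\setminus\{r\}$; $\sum_{e\in\delta^{in}(v)} y_e\ge y_f$ for all $v\in V\setminus\{r\}$ and $f\in\delta^{out}(v)$; $y_e\ge 0$ for all $e\in E$. Let $y^*$ be a feasible solution of the $\ell$-th round Sherali--Adams relaxation of (DST-LP2), with lifted variables $y^*_S$ for $S\subseteq E$, $|S|\le \ell+1$. For each path $p\in Q$ define $x^*_p := y^*_{E(p)}$ (the linearization of $\prod_{e\in p} y_e$), where $E(p)$ is the edge set of $p$. Then $x^*$ is a feasible solution of the linear program (DST-LP1) \[ \min \sum_{e\in E}\sum_{p\in Q(e)} c_e\, x_p \ \text{ s.t. } \sum_{p\in Q(t)} x_p\ge 1\ (t\in T),\quad x_{p'}\ge \sum_{p\in Q(t),\,p'\subseteq p} x_p\ (t\in T,\ p'\in Q),\quad x_p\ge 0\ (p\in Q), \] and its objective value $\sum_{e\in E}\sum_{p\in Q(e)} c_e x^*_p$ is at most the objective value $\sum_{e\in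 E} c_e y^*_{\{e\}}$ of $y^*$.
   Context: $\delta^{in}(v)$ and $\delta^{out}(v)$ denote the sets of edges entering and leaving $v$. For $v\in V$, $Q(v)$ is the set of directed paths from $r$ to $v$; for $e\in E$, $Q(e)$ is the set of directed paths starting at $r$ with last edge $e$; $Q=\bigcup_{v}Q(v)$. For $p',p\in Q$, $p'\subseteq p$ means $p'$ is an initial subpath of $p$. The $\ell$-th round Sherali--Adams relaxation of (DST-LP2) is obtained by (i) multiplying each constraint of (DST-LP2) by every polynomial $\prod_{e'\in E'} y_{e'}\prod_{e''\in E''}(1-y_{e''})$ with $E'\cap E''=\emptyset$ and $|E'\cup E''|\le \ell$, (ii) expanding and replacing every $y_e^2$ by $y_e$, and (iii) linearizing by replacing each monomial $\prod_{e\in S} y_e$ ($S\subseteq E$, $|S|\le\ell+1$) with a nonnegative variable $y_S$, where $y_\emptyset=1$ and $y_{\{e\}}$ plays the role of $y_e$. -}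

module Defs where

open import Level using (0ℓ)
open import Data.Nat as ℕ using (ℕ; zero; suc)
open import Data.Bool using (Bool; true; false; _∧_; _∨_; not; if_then_else_)
open import Data.Fin as Fin using (Fin)
open import Data.Fin.Subset using (Subset; ⁅_⁆; _∪_; _∩_; ∣_∣) renaming (⊥ to ∅)
open import Data.List using (List; []; _∷_; _++_; map; concatMap; foldr; filter; upTo; length)
open import Data.Vec using (Vec)
open import Data.Fin.Subset.Properties using (_∈?_)
open import Data.List using (allFin)
open import Data.Bool using () renaming (_≟_ to _≟B_)
open import Data.Product using (_×_; _,_)
open import Relation.Nullary using (Dec; does; ¬_)
open import Relation.Binary.PropositionalEquality using (_≡_)
open import Relation.Binary.Structures using (IsTotalOrder)
open import Algebra.Bundles using (CommutativeRing)

-- Scalars: a (totally) ordered commutative ring.  The real numbers are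
-- an instance; the paper works over ℝ.

record OrderedCommRing : Set₁ where
  field
    commutativeRing : CommutativeRing 0ℓ 0ℓ
  open CommutativeRing commutativeRing public
  field
    _≤_         : Carrier → Carrier → Set
    isTotalOrder : IsTotalOrder _≈_ _≤_
    +-monoʳ-≤   : ∀ a {b c} → b ≤ c → (a + b) ≤ (a + c)
    *-nonneg    : ∀ {a b} → 0# ≤ a → 0# ≤ b → 0# ≤ (a * b)
  infix 4 _≤_

-- The layer map gives the partition
-- V = V_0 ∪ … ∪ V_ℓ (V_i = layer⁻¹(i)); V_0 = {root}; the terminal
-- set T is V_ℓ.

record LayeredDST (ℓ : ℕ) : Set where
  field
    n m        : ℕ
    tail head  : Fin m → Fin n
    root       : Fin n
    layer      : Fin n → ℕ
    layer≤ℓ    : ∀ v → layer v ℕ.≤ ℓ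
    layer0⇒root : ∀ v → layer v ≡ 0 → v ≡ root
    root-layer0 : layer root ≡ 0
    edge-layer : ∀ e → layer (head e) ≡ suc (layer (tail e))

  Terminal : Fin n → Set
  Terminal v = layer v ≡ ℓ

module DST (R : OrderedCommRing) {ℓ : ℕ} (G : LayeredDST ℓ) where
  open OrderedCommRing R
  open LayeredDST G

  Edge = Fin m

  sumL : List Carrier → Carrier
  sumL = foldr _+_ 0#

  allEdges : List Edge
  allEdges = allFin m

  δin : Fin n → List Edge
  δin v = filter (λ e → head e Fin.≟ v) allEdges

  -- Multilinear polynomials in the variables y_e (e ∈ E), i.e. the
  -- polynomials after the reduction y_e² = y_e: formal sums of terms
  -- coefficient · ∏_{e∈S} y_e.

  Poly : Set
  Poly = List (Carrier × Subset m)

  const : Carrier → Poly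
  const a = (a , ∅) ∷ []

  var : Edge → Poly
  var e = (1# , ⁅ e ⁆) ∷ []

  _⊕_ : Poly → Poly → Poly
  p ⊕ q = p ++ q

  ⊖_ : Poly → Poly
  ⊖ p = map (λ { (a , S) → (- a , S) }) p

  _⊝_ : Poly → Poly → Poly
  p ⊝ q = p ⊕ (⊖ q)

  -- product, with y_e² replaced by y_e (monomials multiply by union)
  _⊗_ : Poly → Poly → Poly
  p ⊗ q = concatMap (λ { (a , S) → map (λ { (b , T) → (a * b , S ∪ T) }) q }) p

  ΣP : List Poly → Poly
  ΣP = foldr _⊕_ []

  ΠP : List Poly → Poly
  ΠP = foldr _⊗_ (const 1#)

  linearize : (Subset m → Carrier) → Poly → Carrier
  linearize y p = sumL (map (λ { (a , S) → a * y S }) p)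

  inSum : Fin n → Poly
  inSum v = ΣP (map var (δin v))

  -- The constraints of (DST-LP2), each written as  g(y) ≥ 0.

  data LP2Constraint : Poly → Set where
    cover  : ∀ t → Terminal t → LP2Constraint (inSum t ⊝ const 1#)
    indeg  : ∀ v → ¬ (v ≡ root) → LP2Constraint (const 1# ⊝ inSum v)
    flow   : ∀ v f → ¬ (v ≡ root) → tail f ≡ v → LP2Constraint (inSum v ⊝ var f)
    nonneg : ∀ e → LP2Constraint (var e)

  multiplier : Subset m → Subset m → Poly
  multiplier E' E'' =
    ΠP (map (λ e → if does (e ∈? E') then var e
                   else if does (e ∈? E'') then (const 1# ⊝ var e)
                   else const 1#) allEdges)

  -- feasibility for the ℓ-th round Sherali–Adams relaxation of (DST-LP2);
  -- y S is the lifted variable y_S (only values with ∣ S ∣ ≤ ℓ+1 matter)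
  record SAFeasible (y : Subset m → Carrier) : Set where
    field
      y∅        : y ∅ ≈ 1#
      y-nonneg  : ∀ S → ∣ S ∣ ℕ.≤ suc ℓ → 0# ≤ y S
      lifted    : ∀ g → LP2Constraint g →
                  ∀ (E' E'' : Subset m) → E' ∩ E'' ≡ ∅ → ∣ E' ∪ E'' ∣ ℕ.≤ ℓ →
                  0# ≤ linearize y (g ⊗ multiplier E' E'')

  -- Directed paths from the root, as lists of edges e₁ … e_k with
  -- tail e₁ = root, head e_i = tail e_{i+1}, and pairwise distinct
  -- vertices.  The empty list is the trivial path at the root.

  endpoint : Fin n → List Edge → Fin n
  endpoint u []       = u
  endpoint u (e ∷ es) = endpoint (head e) es

  isWalkFrom : Fin n → List Edge → Bool
  isWalkFrom u []       = true
  isWalkFrom u (e ∷ es) = does (tail e Fin.≟ u) ∧ isWalkFrom (head e) es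

  vertices : Fin n → List Edge → List (Fin n)
  vertices u es = u ∷ map head es

  memB : Fin n → List (Fin n) → Bool
  memB v []       = false
  memB v (w ∷ ws) = does (v Fin.≟ w) ∨ memB v ws

  distinctB : List (Fin n) → Bool
  distinctB []       = true
  distinctB (v ∷ vs) = not (memB v vs) ∧ distinctB vs

  isPath : List Edge → Bool
  isPath es = isWalkFrom root es ∧ distinctB (vertices root es)

  isPathTo : Fin n → List Edge → Bool
  isPathTo v es = isPath es ∧ does (endpoint root es Fin.≟ v)

  lastIs : Edge → List Edge → Bool
  lastIs e []           = false
  lastIs e (f ∷ [])     = does (f Fin.≟ e)
  lastIs e (f ∷ g ∷ es) = lastIs e (g ∷ es)

  isPathLast : Edge → List Edge → Bool
  isPathLast e es = isPath es ∧ lastIs e es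

  -- p' ⊆ p : p' is an initial subpath of p
  isPrefix : List Edge → List Edge → Bool
  isPrefix []       _        = true
  isPrefix (_ ∷ _)  []       = false
  isPrefix (e ∷ es) (f ∷ fs) = does (e Fin.≟ f) ∧ isPrefix es fs

  listsOfLength : ℕ → List (List Edge)
  listsOfLength zero    = [] ∷ []
  listsOfLength (suc k) = concatMap (λ e → map (e ∷_) (listsOfLength k)) allEdges

  -- all edge lists of length ≤ n; every path (distinct vertices) has
  -- fewer than n edges, so this list contains every element of Q once
  candidates : List (List Edge)
  candidates = concatMap listsOfLength (upTo (suc n))

  sumOver : (List Edge → Bool) → (List Edge → Carrier) → Carrier
  sumOver P f = sumL (map f (filter (λ p → P p ≟B true) candidates))

  edgeSet : List Edge → Subset m
  edgeSet = foldr (λ e S → ⁅ e ⁆ ∪ S) ∅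

  xStar : (Subset m → Carrier) → List Edge → Carrier
  xStar y p = y (edgeSet p)

  record LP1Feasible (x : List Edge → Carrier) : Set where
    field
      cover1  : ∀ t → Terminal t → 1# ≤ sumOver (isPathTo t) x
      prefix1 : ∀ t → Terminal t → ∀ p' → isPath p' ≡ true →
               sumOver (λ p → isPathTo t p ∧ isPrefix p' p) x ≤ x p'
      nonneg1 : ∀ p → isPath p ≡ true → 0# ≤ x p

  objLP1 : (Edge → Carrier) → (List Edge → Carrier) → Carrier
  objLP1 c x = sumL (map (λ e → sumOver (isPathLast e) (λ p → c e * x p)) allEdges)

  objLP2 : (Edge → Carrier) → (Subset m → Carrier) → Carrier
  objLP2 c y = sumL (map (λ e → c e * y ⁅ e ⁆) allEdges)

-- Only the Sherali–Adams multipliers ∏_{e∈S} y_e (E'' = ∅) are needed. Multiplying the LP2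
-- constraints at a vertex u by y_S (|S| ≤ ℓ) and linearizing gives
--   y_S ≤ ∑_{e∈δin(u)} y_{S∪{e}}   if u is a terminal or S contains an edge leaving u,
--   ∑_{e∈δin(u)} y_{S∪{e}} ≤ y_S   if u ≠ root.
-- Iterating the first inequality backwards through the layers, starting from a terminal t and
-- S = ∅, gives 1 = y_∅ ≤ ∑_{p∈Q(t)} x*_p. Iterating the second one backwards from t to the end of
-- a path p' (starting from S = E(p')), resp. from the tail of e to the root (starting from
-- S = {e}), bounds the x*-mass of the paths extending p' by x*_{p'}, resp. that of Q(e) by y_{e}.
-- In a layered graph every walk from the root is a path whose length is the layer of its
-- endpoint; this keeps all lifted sets of size at most ℓ + 1 and turns each sum over Q into a
-- sum over the edge lists of a single length.

module Submission where

open import Level using (0ℓ)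
open import Function using (_∘_)
open import Data.Bool using (Bool; true; false; _∧_; if_then_else_) renaming (_≟_ to _≟ᵇ_)
open import Data.Bool.Properties using (∧-assoc; ∧-identityʳ)
open import Data.Empty using (⊥-elim)
open import Data.Fin using (Fin; zero; suc; toℕ; _≟_)
open import Data.Fin.Properties using (injective⇒≤; toℕ-injective)
open import Data.Fin.Subset using (Subset; ⁅_⁆; _∪_; _⊆_; ∣_∣) renaming (⊥ to ∅; _∈_ to _∈ₛ_)
open import Data.Fin.Subset.Properties
  using (_∈?_; ∉⊥; x∈⁅x⁆; x∈⁅y⁆⇒x≡y; x∈p∪q⁻; x∈p∪q⁺; ⊆-antisym; ∩-zeroʳ; ∪-identityˡ; ∪-identityʳ;
         ∪-assoc; ∪-comm; ∪-idem; ∣⊥∣≡0; ∣⁅x⁆∣≡1)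
open import Data.List using (List; []; _∷_; _++_; [_]; map; concatMap; foldr; filter; length; upTo)
open import Data.List.Membership.Propositional using (_∈_)
open import Data.List.Membership.Propositional.Properties using (∈-allFin; ∈-upTo⁺)
open import Data.List.Relation.Unary.All as All using (All; []; _∷_)
open import Data.List.Relation.Unary.All.Properties using (map⁺; concat⁺)
open import Data.List.Relation.Unary.Any using (here; there)
open import Data.List.Relation.Unary.AllPairs using (_∷_)
open import Data.List.Relation.Unary.Unique.Propositional using (Unique)
open import Data.List.Relation.Unary.Unique.Propositional.Properties using (upTo⁺; allFin⁺)
open import Data.Nat as ℕ using (ℕ; zero; suc)
import Data.Nat.Properties as ℕₚ
open import Data.Product using (Σ-syntax; _×_; _,_; proj₁)
open import Data.Sum using (_⊎_; inj₁; inj₂)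
import Data.Vec as Vec
open import Relation.Binary.Bundles using (Poset)
open import Relation.Binary.Definitions using (DecidableEquality)
open import Relation.Binary.PropositionalEquality as ≡ using (_≡_; _≢_; refl)
open import Relation.Binary.Structures using (IsTotalOrder)
open import Relation.Nullary using (Dec; yes; no; does; ¬_)
open import Relation.Nullary.Decidable using (dec-true)
open import Relation.Unary using (Decidable)

open import Defs

≟-sym : ∀ {A : Set} (_≟ₐ_ : DecidableEquality A) x y → does (x ≟ₐ y) ≡ does (y ≟ₐ x)
≟-sym _≟ₐ_ x y with x ≟ₐ y | y ≟ₐ x
... | yes _   | yes _   = refl
... | no _    | no _    = refl
... | yes x≡y | no y≢x  = ⊥-elim (y≢x (≡.sym x≡y))
... | no x≢y  | yes y≡x = ⊥-elim (x≢y (≡.sym y≡x))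

does-true⁻ : ∀ {P : Set} (P? : Dec P) → does P? ≡ true → P
does-true⁻ (yes p) _ = p

does-≟ᵇ-true : ∀ b → does (b ≟ᵇ true) ≡ b
does-≟ᵇ-true true  = refl
does-≟ᵇ-true false = refl

∧-true⁻ : ∀ {a b} → a ∧ b ≡ true → a ≡ true × b ≡ true
∧-true⁻ {true} {true} _ = refl , refl

∣p∪q∣≤∣p∣+∣q∣ : ∀ {k} (p q : Subset k) → ∣ p ∪ q ∣ ℕ.≤ ∣ p ∣ ℕ.+ ∣ q ∣
∣p∪q∣≤∣p∣+∣q∣ Vec.[]          Vec.[]          = ℕ.z≤n
∣p∪q∣≤∣p∣+∣q∣ (true  Vec.∷ p) (false Vec.∷ q) = ℕ.s≤s (∣p∪q∣≤∣p∣+∣q∣ p q)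
∣p∪q∣≤∣p∣+∣q∣ (true  Vec.∷ p) (true  Vec.∷ q) =
  ℕ.s≤s (ℕₚ.≤-trans (∣p∪q∣≤∣p∣+∣q∣ p q) (ℕₚ.+-monoʳ-≤ ∣ p ∣ (ℕₚ.n≤1+n ∣ q ∣)))
∣p∪q∣≤∣p∣+∣q∣ (false Vec.∷ p) (true  Vec.∷ q) =
  ℕₚ.≤-trans (ℕ.s≤s (∣p∪q∣≤∣p∣+∣q∣ p q)) (ℕₚ.≤-reflexive (≡.sym (ℕₚ.+-suc ∣ p ∣ ∣ q ∣)))
∣p∪q∣≤∣p∣+∣q∣ (false Vec.∷ p) (false Vec.∷ q) = ∣p∪q∣≤∣p∣+∣q∣ p q

∣⁅x⁆∪p∣≤1+∣p∣ : ∀ {n} (x : Fin n) p → ∣ ⁅ x ⁆ ∪ p ∣ ℕ.≤ suc ∣ p ∣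
∣⁅x⁆∪p∣≤1+∣p∣ x p =
  ℕₚ.≤-trans (∣p∪q∣≤∣p∣+∣q∣ ⁅ x ⁆ p) (ℕₚ.≤-reflexive (≡.cong (ℕ._+ ∣ p ∣) (∣⁅x⁆∣≡1 x)))

∣⁅x⁆∪p∣+k≤∣p∣+1+k : ∀ {n} (x : Fin n) p k → ∣ ⁅ x ⁆ ∪ p ∣ ℕ.+ k ℕ.≤ ∣ p ∣ ℕ.+ suc k
∣⁅x⁆∪p∣+k≤∣p∣+1+k x p k =
  ℕₚ.≤-trans (ℕₚ.+-monoˡ-≤ k (∣⁅x⁆∪p∣≤1+∣p∣ x p)) (ℕₚ.≤-reflexive (≡.sym (ℕₚ.+-suc ∣ p ∣ k)))

∪-idemˡ : ∀ {n} (p q : Subset n) → p ∪ (p ∪ q) ≡ p ∪ q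
∪-idemˡ p q = ≡.trans (≡.sym (∪-assoc p p q)) (≡.cong (_∪ q) (∪-idem p))

module OrderedCommRingProperties (R : OrderedCommRing) where
  open OrderedCommRing R renaming (refl to ≈-refl)
  open import Algebra.Properties.Ring ring using (-‿distribʳ-*)
  open import Algebra.Properties.CommutativeSemigroup +-commutativeSemigroup using (interchange)

  poset : Poset 0ℓ 0ℓ 0ℓ
  poset = record { isPartialOrder = IsTotalOrder.isPartialOrder isTotalOrder }

  open Poset poset public
    using (≤-respˡ-≈) renaming (refl to ≤-refl; reflexive to ≤-reflexive; trans to ≤-trans)
  open import Relation.Binary.Reasoning.PartialOrder poset public

  +-monoˡ-≤ : ∀ c {a b} → a ≤ b → a + c ≤ b + c
  +-monoˡ-≤ c {a} {b} a≤b = begin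
    a + c  ≈⟨ +-comm a c ⟩
    c + a  ≤⟨ +-monoʳ-≤ c a≤b ⟩
    c + b  ≈⟨ +-comm c b ⟩
    b + c  ∎

  +-mono-≤ : ∀ {a b c d} → a ≤ b → c ≤ d → a + c ≤ b + d
  +-mono-≤ {b = b} {c} a≤b c≤d = ≤-trans (+-monoˡ-≤ c a≤b) (+-monoʳ-≤ b c≤d)

  nonneg-diff⇒≤ : ∀ {a b} → 0# ≤ a + - b → b ≤ a
  nonneg-diff⇒≤ {a} {b} 0≤a-b = begin
    b               ≈⟨ +-identityʳ b ⟨
    b + 0#          ≤⟨ +-monoʳ-≤ b 0≤a-b ⟩
    b + (a + - b)   ≈⟨ +-comm b (a + - b) ⟩
    (a + - b) + b   ≈⟨ +-assoc a (- b) b ⟩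
    a + (- b + b)   ≈⟨ +-congˡ (-‿inverseˡ b) ⟩
    a + 0#          ≈⟨ +-identityʳ a ⟩
    a               ∎

  ≤⇒nonneg-diff : ∀ {a b} → b ≤ a → 0# ≤ a + - b
  ≤⇒nonneg-diff {a} {b} b≤a = begin
    0#       ≈⟨ -‿inverseʳ b ⟨
    b + - b  ≤⟨ +-monoˡ-≤ (- b) b≤a ⟩
    a + - b  ∎

  *-monoˡ-≤-nonNeg : ∀ {c a b} → 0# ≤ c → a ≤ b → c * a ≤ c * b
  *-monoˡ-≤-nonNeg {c} {a} {b} 0≤c a≤b = nonneg-diff⇒≤ (begin
    0#                   ≤⟨ *-nonneg 0≤c (≤⇒nonneg-diff a≤b) ⟩
    c * (b + - a)        ≈⟨ distribˡ c b (- a) ⟩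
    c * b + c * - a      ≈⟨ +-congˡ (-‿distribʳ-* c a) ⟨
    c * b + - (c * a)    ∎)

  when : Bool → Carrier → Carrier
  when b x = if b then x else 0#

  when-∧ : ∀ a b x → when (a ∧ b) x ≡ when a (when b x)
  when-∧ true  b x = refl
  when-∧ false b x = refl

  when-comm : ∀ a b x → when a (when b x) ≡ when b (when a x)
  when-comm true  true  x = refl
  when-comm true  false x = refl
  when-comm false true  x = refl
  when-comm false false x = refl

  when-cong : ∀ b {x y} → x ≈ y → when b x ≈ when b y
  when-cong true  x≈y = x≈y
  when-cong false x≈y = ≈-refl

  when-≤ : ∀ b {x y} → 0# ≤ y → x ≤ y → when b x ≤ y
  when-≤ true  0≤y x≤y = x≤y
  when-≤ false 0≤y x≤y = 0≤y

  when-dec-mono : ∀ {P : Set} (P? : Dec P) {x y} → (P → x ≤ y) → when (does P?) x ≤ when (does P?) y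
  when-dec-mono (yes p) x≤y = x≤y p
  when-dec-mono (no _)  x≤y = ≤-refl

  ∑ : {A : Set} → List A → (A → Carrier) → Carrier
  ∑ xs f = foldr _+_ 0# (map f xs)

  infix 5 ∑
  syntax ∑ xs (λ x → e) = ∑[ x ∈ xs ] e

  module _ {A : Set} where

    ∑-cong : ∀ (xs : List A) {f g} → (∀ x → f x ≈ g x) → ∑ xs f ≈ ∑ xs g
    ∑-cong []       f≈g = ≈-refl
    ∑-cong (x ∷ xs) f≈g = +-cong (f≈g x) (∑-cong xs f≈g)

    ∑-mono-≤ : ∀ (xs : List A) {f g} → (∀ x → f x ≤ g x) → ∑ xs f ≤ ∑ xs g
    ∑-mono-≤ []       f≤g = ≤-refl
    ∑-mono-≤ (x ∷ xs) f≤g = +-mono-≤ (f≤g x) (∑-mono-≤ xs f≤g)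

    ∑-zero : ∀ {xs : List A} {f} → All (λ x → f x ≈ 0#) xs → ∑ xs f ≈ 0#
    ∑-zero []           = ≈-refl
    ∑-zero (fx≈0 ∷ all) = trans (+-cong fx≈0 (∑-zero all)) (+-identityˡ 0#)

    ∑-++ : ∀ (xs ys : List A) f → ∑ (xs ++ ys) f ≈ ∑ xs f + ∑ ys f
    ∑-++ []       ys f = sym (+-identityˡ _)
    ∑-++ (x ∷ xs) ys f = trans (+-congˡ (∑-++ xs ys f)) (sym (+-assoc _ _ _))

    ∑-+ : ∀ (xs : List A) f g → ∑[ x ∈ xs ] (f x + g x) ≈ ∑ xs f + ∑ xs g
    ∑-+ []       f g = sym (+-identityˡ 0#)
    ∑-+ (x ∷ xs) f g = trans (+-congˡ (∑-+ xs f g)) (interchange _ _ _ _)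

    ∑-*ˡ : ∀ (xs : List A) c f → ∑[ x ∈ xs ] (c * f x) ≈ c * ∑ xs f
    ∑-*ˡ []       c f = sym (zeroʳ c)
    ∑-*ˡ (x ∷ xs) c f = trans (+-congˡ (∑-*ˡ xs c f)) (sym (distribˡ c _ _))

    ∑-when : ∀ (xs : List A) b f → ∑[ x ∈ xs ] when b (f x) ≈ when b (∑ xs f)
    ∑-when xs true  f = ≈-refl
    ∑-when xs false f = ∑-zero {xs = xs} (All.tabulate (λ _ → ≈-refl))

    ∑-filter : ∀ {Pr : A → Set} (P? : Decidable Pr) (xs : List A) f →
               ∑ (filter P? xs) f ≈ ∑[ x ∈ xs ] when (does (P? x)) (f x)
    ∑-filter P? []       f = ≈-refl
    ∑-filter P? (x ∷ xs) f with does (P? x)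
    ... | true  = +-congˡ (∑-filter P? xs f)
    ... | false = trans (∑-filter P? xs f) (sym (+-identityˡ _))

    ∑-single : ∀ {xs : List A} {x f} → Unique xs → x ∈ xs → (∀ z → z ≢ x → f z ≈ 0#) → ∑ xs f ≈ f x
    ∑-single {x ∷ xs} {f = f} (x∉xs ∷ _) (here refl) off = begin-equality
      f x + ∑ xs f  ≈⟨ +-congˡ (∑-zero (All.map (λ x≢z → off _ (x≢z ∘ ≡.sym)) x∉xs)) ⟩
      f x + 0#      ≈⟨ +-identityʳ (f x) ⟩
      f x           ∎
    ∑-single {w ∷ xs} {x} {f} (w∉xs ∷ unique) (there x∈xs) off = begin-equality
      f w + ∑ xs f  ≈⟨ +-cong (off w (All.lookup w∉xs x∈xs)) (∑-single unique x∈xs off) ⟩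
      0# + f x      ≈⟨ +-identityˡ (f x) ⟩
      f x           ∎

    ∑-when-≡ : (_≟ₐ_ : DecidableEquality A) {xs : List A} {x : A} (h : A → Carrier) → Unique xs → x ∈ xs →
               ∑[ z ∈ xs ] when (does (z ≟ₐ x)) (h z) ≈ h x
    ∑-when-≡ _≟ₐ_ {x = x} h unique x∈xs = trans (∑-single unique x∈xs off) (on x refl)
      where
      off : ∀ z → z ≢ x → when (does (z ≟ₐ x)) (h z) ≈ 0#
      off z z≢x with z ≟ₐ x
      ... | yes z≡x = ⊥-elim (z≢x z≡x)
      ... | no  _   = ≈-refl
      on : ∀ z → z ≡ x → when (does (z ≟ₐ x)) (h z) ≈ h z
      on z z≡x with z ≟ₐ x
      ... | yes _   = ≈-refl
      ... | no z≢x  = ⊥-elim (z≢x z≡x)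

  ∑-map : ∀ {A B : Set} (xs : List A) (h : A → B) f → ∑ (map h xs) f ≡ ∑ xs (f ∘ h)
  ∑-map []       h f = refl
  ∑-map (x ∷ xs) h f = ≡.cong (f (h x) +_) (∑-map xs h f)

  ∑-concatMap : ∀ {A B : Set} (xs : List A) (g : A → List B) f →
                ∑ (concatMap g xs) f ≈ ∑[ x ∈ xs ] ∑ (g x) f
  ∑-concatMap []       g f = ≈-refl
  ∑-concatMap (x ∷ xs) g f = trans (∑-++ (g x) (concatMap g xs) f) (+-congˡ (∑-concatMap xs g f))

  ∑-swap : ∀ {A B : Set} (xs : List A) (ys : List B) (f : A → B → Carrier) →
           ∑[ x ∈ xs ] ∑ ys (f x) ≈ ∑[ y ∈ ys ] ∑[ x ∈ xs ] f x y
  ∑-swap []       ys f = sym (∑-zero {xs = ys} (All.tabulate (λ _ → ≈-refl)))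
  ∑-swap (x ∷ xs) ys f = trans (+-congˡ (∑-swap xs ys f)) (sym (∑-+ ys (f x) _))

module LayeredWalks (R : OrderedCommRing) {ℓ : ℕ} (G : LayeredDST ℓ) where
  open OrderedCommRing R renaming (refl to ≈-refl)
  open OrderedCommRingProperties R
  open LayeredDST G
  open DST R G

  isWalkFromTo : Fin n → Fin n → List Edge → Bool
  isWalkFromTo u v w = isWalkFrom u w ∧ does (endpoint u w ≟ v)

  endpoint-++ : ∀ u w w' → endpoint u (w ++ w') ≡ endpoint (endpoint u w) w'
  endpoint-++ u []      w' = refl
  endpoint-++ u (e ∷ w) w' = endpoint-++ (head e) w w'

  isWalkFrom-++ : ∀ u w w' → isWalkFrom u (w ++ w') ≡ isWalkFrom u w ∧ isWalkFrom (endpoint u w) w'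
  isWalkFrom-++ u []      w' = refl
  isWalkFrom-++ u (e ∷ w) w' =
    ≡.trans (≡.cong (does (tail e ≟ u) ∧_) (isWalkFrom-++ (head e) w w'))
            (≡.sym (∧-assoc (does (tail e ≟ u)) (isWalkFrom (head e) w) _))

  isWalkFrom-∷ʳ : ∀ u w e → isWalkFrom u (w ++ [ e ]) ≡ isWalkFromTo u (tail e) w
  isWalkFrom-∷ʳ u w e = ≡.trans (isWalkFrom-++ u w [ e ])
    (≡.cong (isWalkFrom u w ∧_) (≡.trans (∧-identityʳ _) (≟-sym _≟_ (tail e) (endpoint u w))))

  isWalkFromTo-∷ʳ : ∀ u v w e → isWalkFromTo u v (w ++ [ e ]) ≡ isWalkFromTo u (tail e) w ∧ does (head e ≟ v)
  isWalkFromTo-∷ʳ u v w e =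
    ≡.cong₂ _∧_ (isWalkFrom-∷ʳ u w e) (≡.cong (λ x → does (x ≟ v)) (endpoint-++ u w [ e ]))

  isWalkFromTo-++ : ∀ u v w w' → isWalkFrom u w ≡ true →
                    isWalkFromTo u v (w ++ w') ≡ isWalkFromTo (endpoint u w) v w'
  isWalkFromTo-++ u v w w' walk rewrite isWalkFrom-++ u w w' | walk | endpoint-++ u w w' = refl

  isWalkFrom-∷⁻ : ∀ {u e w} → isWalkFrom u (e ∷ w) ≡ true → tail e ≡ u × isWalkFrom (head e) w ≡ true
  isWalkFrom-∷⁻ {u} {e} walk with tail e ≟ u
  ... | yes tail≡u = tail≡u , walk

  layer-endpoint : ∀ u w → isWalkFrom u w ≡ true → layer (endpoint u w) ≡ length w ℕ.+ layer u
  layer-endpoint u []      _    = refl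
  layer-endpoint u (e ∷ w) walk with refl , walk' ← isWalkFrom-∷⁻ {u} {e} {w} walk =
    ≡.trans (layer-endpoint (head e) w walk')
            (≡.trans (≡.cong (length w ℕ.+_) (edge-layer e)) (ℕₚ.+-suc (length w) (layer u)))

  vertexAt : (u : Fin n) (w : List Edge) → Fin (suc (length w)) → Fin n
  vertexAt u w       zero    = u
  vertexAt u (e ∷ w) (suc i) = vertexAt (head e) w i

  layer-vertexAt : ∀ u w → isWalkFrom u w ≡ true → ∀ i → layer (vertexAt u w i) ≡ toℕ i ℕ.+ layer u
  layer-vertexAt u w       _    zero    = refl
  layer-vertexAt u (e ∷ w) walk (suc i) with refl , walk' ← isWalkFrom-∷⁻ {u} {e} {w} walk =
    ≡.trans (layer-vertexAt (head e) w walk' i)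
            (≡.trans (≡.cong (toℕ i ℕ.+_) (edge-layer e)) (ℕₚ.+-suc (toℕ i) (layer u)))

  -- Layers increase by one along a walk, so vertexAt is injective.
  walk-length< : ∀ u w → isWalkFrom u w ≡ true → length w ℕ.< n
  walk-length< u w walk = injective⇒≤ vertexAt-injective
    where
    vertexAt-injective : ∀ {i j} → vertexAt u w i ≡ vertexAt u w j → i ≡ j
    vertexAt-injective {i} {j} same = toℕ-injective (ℕₚ.+-cancelʳ-≡ (layer u) (toℕ i) (toℕ j)
      (≡.trans (≡.sym (layer-vertexAt u w walk i)) (≡.trans (≡.cong layer same) (layer-vertexAt u w walk j))))

  memB-heads : ∀ u w x → isWalkFrom u w ≡ true → layer x ℕ.≤ layer u → memB x (map head w) ≡ false
  memB-heads u []      x _    _   = refl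
  memB-heads u (e ∷ w) x walk x≤u with refl , walk' ← isWalkFrom-∷⁻ {u} {e} {w} walk | x ≟ head e
  ... | yes refl = ⊥-elim (ℕₚ.≤⇒≯ x≤u (ℕₚ.≤-reflexive (≡.sym (edge-layer e))))
  ... | no _     = memB-heads (head e) w x walk'
                     (≡.subst (layer x ℕ.≤_) (≡.sym (edge-layer e)) (ℕₚ.m≤n⇒m≤1+n x≤u))

  walk⇒distinct : ∀ u w → isWalkFrom u w ≡ true → distinctB (vertices u w) ≡ true
  walk⇒distinct u []      _    = refl
  walk⇒distinct u (e ∷ w) walk with refl , walk' ← isWalkFrom-∷⁻ {u} {e} {w} walk
    rewrite memB-heads u (e ∷ w) u walk ℕₚ.≤-refl = walk⇒distinct (head e) w walk'

  isPath≡isWalkFrom : ∀ w → isPath w ≡ isWalkFrom root w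
  isPath≡isWalkFrom w with isWalkFrom root w in walk
  ... | true  = walk⇒distinct root w walk
  ... | false = refl

  isPathTo≡isWalkFromTo : ∀ v w → isPathTo v w ≡ isWalkFromTo root v w
  isPathTo≡isWalkFromTo v w = ≡.cong (_∧ does (endpoint root w ≟ v)) (isPath≡isWalkFrom w)

  path⇒walk : ∀ w → isPath w ≡ true → isWalkFrom root w ≡ true
  path⇒walk w path = ≡.trans (≡.sym (isPath≡isWalkFrom w)) path

  layer-endpoint-root : ∀ w → isWalkFrom root w ≡ true → layer (endpoint root w) ≡ length w
  layer-endpoint-root w walk = ≡.trans (layer-endpoint root w walk)
    (≡.trans (≡.cong (length w ℕ.+_) root-layer0) (ℕₚ.+-identityʳ (length w)))

  path-length≤ℓ : ∀ w → isPath w ≡ true → length w ℕ.≤ ℓ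
  path-length≤ℓ w path =
    ≡.subst (ℕ._≤ ℓ) (layer-endpoint-root w (path⇒walk w path)) (layer≤ℓ (endpoint root w))

  pathTo-length : ∀ v p → isPathTo v p ≡ true → isPath p ≡ true × length p ≡ layer v
  pathTo-length v p pathTo with path , ends ← ∧-true⁻ pathTo =
    path , ≡.trans (≡.sym (layer-endpoint-root p (path⇒walk p path)))
                   (≡.cong layer (does-true⁻ (endpoint root p ≟ v) ends))

  lastIs⇒endpoint : ∀ e u p → lastIs e p ≡ true → endpoint u p ≡ head e
  lastIs⇒endpoint e u (f ∷ [])    last with refl ← does-true⁻ (f ≟ e) last = refl
  lastIs⇒endpoint e u (f ∷ g ∷ p) last = lastIs⇒endpoint e (head f) (g ∷ p) last

  lastIs-∷ʳ : ∀ e w f → lastIs e (w ++ [ f ]) ≡ does (f ≟ e)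
  lastIs-∷ʳ e []          f = refl
  lastIs-∷ʳ e (g ∷ [])    f = refl
  lastIs-∷ʳ e (g ∷ h ∷ w) f = lastIs-∷ʳ e (h ∷ w) f

  pathLast-length : ∀ e p → isPathLast e p ≡ true → isPath p ≡ true × length p ≡ suc (layer (tail e))
  pathLast-length e p pathLast with path , last ← ∧-true⁻ pathLast =
    path , ≡.trans (≡.sym (layer-endpoint-root p (path⇒walk p path)))
                   (≡.trans (≡.cong layer (lastIs⇒endpoint e root p last)) (edge-layer e))

  layer≡suc⇒≢root : ∀ {u k} → layer u ≡ suc k → u ≢ root
  layer≡suc⇒≢root layer≡suc refl = ℕₚ.0≢1+n (≡.trans (≡.sym root-layer0) layer≡suc)

  layer-tail : ∀ e {k} → layer (head e) ≡ suc k → layer (tail e) ≡ k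
  layer-tail e layer≡suc = ℕₚ.suc-injective (≡.trans (≡.sym (edge-layer e)) layer≡suc)

  edgeSet-++ : ∀ w w' → edgeSet (w ++ w') ≡ edgeSet w ∪ edgeSet w'
  edgeSet-++ []      w' = ≡.sym (∪-identityˡ _)
  edgeSet-++ (e ∷ w) w' = ≡.trans (≡.cong (⁅ e ⁆ ∪_) (edgeSet-++ w w')) (≡.sym (∪-assoc ⁅ e ⁆ _ _))

  edgeSet-∷ʳ : ∀ w e → edgeSet (w ++ [ e ]) ≡ ⁅ e ⁆ ∪ edgeSet w
  edgeSet-∷ʳ w e = ≡.trans (edgeSet-++ w [ e ])
    (≡.trans (≡.cong (edgeSet w ∪_) (∪-identityʳ ⁅ e ⁆)) (∪-comm (edgeSet w) ⁅ e ⁆))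

  ∪-edgeSet-∷ʳ : ∀ S w e → S ∪ edgeSet (w ++ [ e ]) ≡ (⁅ e ⁆ ∪ S) ∪ edgeSet w
  ∪-edgeSet-∷ʳ S w e = ≡.trans (≡.cong (S ∪_) (edgeSet-∷ʳ w e))
    (≡.trans (≡.sym (∪-assoc S ⁅ e ⁆ (edgeSet w))) (≡.cong (_∪ edgeSet w) (∪-comm S ⁅ e ⁆)))

  ∣edgeSet∣≤length : ∀ w → ∣ edgeSet w ∣ ℕ.≤ length w
  ∣edgeSet∣≤length []      = ℕₚ.≤-reflexive (∣⊥∣≡0 m)
  ∣edgeSet∣≤length (e ∷ w) = ℕₚ.≤-trans (∣⁅x⁆∪p∣≤1+∣p∣ e (edgeSet w)) (ℕ.s≤s (∣edgeSet∣≤length w))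

  listsOfLength-length : ∀ k → All (λ w → length w ≡ k) (listsOfLength k)
  listsOfLength-length zero    = refl ∷ []
  listsOfLength-length (suc k) =
    concat⁺ (map⁺ {xs = allEdges} {f = λ e → map (e ∷_) (listsOfLength k)}
      (All.tabulate (λ {e} _ → map⁺ {f = e ∷_} (All.map (≡.cong suc) (listsOfLength-length k)))))

  ∑-listsOfLength-∷ : ∀ k g → ∑ (listsOfLength (suc k)) g ≈ ∑[ e ∈ allEdges ] ∑[ w ∈ listsOfLength k ] g (e ∷ w)
  ∑-listsOfLength-∷ k g = trans (∑-concatMap allEdges (λ e → map (e ∷_) (listsOfLength k)) g)
    (∑-cong allEdges (λ e → reflexive (∑-map (listsOfLength k) (e ∷_) g)))

  ∑-listsOfLength-∷ʳ : ∀ k g →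
    ∑ (listsOfLength (suc k)) g ≈ ∑[ w ∈ listsOfLength k ] ∑[ e ∈ allEdges ] g (w ++ [ e ])
  ∑-listsOfLength-∷ʳ zero    g = trans (∑-listsOfLength-∷ 0 g)
    (trans (∑-cong allEdges (λ e → +-identityʳ _)) (sym (+-identityʳ _)))
  ∑-listsOfLength-∷ʳ (suc k) g = begin-equality
    ∑ (listsOfLength (suc (suc k))) g
      ≈⟨ ∑-listsOfLength-∷ (suc k) g ⟩
    ∑[ e ∈ allEdges ] ∑[ w ∈ listsOfLength (suc k) ] g (e ∷ w)
      ≈⟨ ∑-cong allEdges (λ e → ∑-listsOfLength-∷ʳ k (λ w → g (e ∷ w))) ⟩
    ∑[ e ∈ allEdges ] ∑[ w ∈ listsOfLength k ] ∑[ f ∈ allEdges ] g (e ∷ w ++ [ f ])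
      ≈⟨ ∑-listsOfLength-∷ k (λ w → ∑[ f ∈ allEdges ] g (w ++ [ f ])) ⟨
    ∑[ w ∈ listsOfLength (suc k) ] ∑[ f ∈ allEdges ] g (w ++ [ f ]) ∎

  walkSum : Fin n → Fin n → ℕ → (List Edge → Carrier) → Carrier
  walkSum u v k F = ∑[ w ∈ listsOfLength k ] when (isWalkFromTo u v w) (F w)

  walkSum-cong : ∀ u v k {F F'} → (∀ w → F w ≈ F' w) → walkSum u v k F ≈ walkSum u v k F'
  walkSum-cong u v k F≈F' = ∑-cong (listsOfLength k) (λ w → when-cong (isWalkFromTo u v w) (F≈F' w))

  walkSum-zero : ∀ u v F → walkSum u v 0 F ≈ when (does (u ≟ v)) (F [])
  walkSum-zero u v F = +-identityʳ _

  walkSum-suc : ∀ u v k F → walkSum u v (suc k) F ≈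
                ∑[ e ∈ allEdges ] when (does (head e ≟ v)) (walkSum u (tail e) k (λ w → F (w ++ [ e ])))
  walkSum-suc u v k F = begin-equality
    walkSum u v (suc k) F
      ≈⟨ ∑-listsOfLength-∷ʳ k _ ⟩
    ∑[ w ∈ listsOfLength k ] ∑[ e ∈ allEdges ] when (isWalkFromTo u v (w ++ [ e ])) (F (w ++ [ e ]))
      ≈⟨ ∑-cong (listsOfLength k) (λ w → ∑-cong allEdges (λ e → reflexive (lastStep w e))) ⟩
    ∑[ w ∈ listsOfLength k ] ∑[ e ∈ allEdges ]
      when (does (head e ≟ v)) (when (isWalkFromTo u (tail e) w) (F (w ++ [ e ])))
      ≈⟨ ∑-swap (listsOfLength k) allEdges _ ⟩
    ∑[ e ∈ allEdges ] ∑[ w ∈ listsOfLength k ]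
      when (does (head e ≟ v)) (when (isWalkFromTo u (tail e) w) (F (w ++ [ e ])))
      ≈⟨ ∑-cong allEdges (λ e → ∑-when (listsOfLength k) (does (head e ≟ v)) _) ⟩
    ∑[ e ∈ allEdges ] when (does (head e ≟ v)) (walkSum u (tail e) k (λ w → F (w ++ [ e ]))) ∎
    where
    lastStep : ∀ w e → when (isWalkFromTo u v (w ++ [ e ])) (F (w ++ [ e ]))
                       ≡ when (does (head e ≟ v)) (when (isWalkFromTo u (tail e) w) (F (w ++ [ e ])))
    lastStep w e = ≡.trans (≡.cong (λ b → when b (F (w ++ [ e ]))) (isWalkFromTo-∷ʳ u v w e))
                           (≡.trans (when-∧ (isWalkFromTo u (tail e) w) (does (head e ≟ v)) _)
                                    (when-comm (isWalkFromTo u (tail e) w) (does (head e ≟ v)) _))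

  ∑-isPrefix : ∀ p' b (g : List Edge → Carrier) →
               ∑[ p ∈ listsOfLength (length p' ℕ.+ b) ] when (isPrefix p' p) (g p)
               ≈ ∑[ q ∈ listsOfLength b ] g (p' ++ q)
  ∑-isPrefix []       b g = ≈-refl
  ∑-isPrefix (e ∷ p') b g = begin-equality
    ∑[ p ∈ listsOfLength (suc (length p' ℕ.+ b)) ] when (isPrefix (e ∷ p') p) (g p)
      ≈⟨ ∑-listsOfLength-∷ (length p' ℕ.+ b) _ ⟩
    ∑[ f ∈ allEdges ] ∑[ p ∈ rest ] when (does (e ≟ f) ∧ isPrefix p' p) (g (f ∷ p))
      ≈⟨ ∑-cong allEdges firstEdge ⟩
    ∑[ f ∈ allEdges ] when (does (f ≟ e)) (∑[ p ∈ rest ] when (isPrefix p' p) (g (f ∷ p)))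
      ≈⟨ ∑-when-≡ _≟_ (λ f → ∑[ p ∈ rest ] when (isPrefix p' p) (g (f ∷ p))) (allFin⁺ m) (∈-allFin e) ⟩
    ∑[ p ∈ rest ] when (isPrefix p' p) (g (e ∷ p))
      ≈⟨ ∑-isPrefix p' b (λ p → g (e ∷ p)) ⟩
    ∑[ q ∈ listsOfLength b ] g (e ∷ p' ++ q) ∎
    where
    rest : List (List Edge)
    rest = listsOfLength (length p' ℕ.+ b)
    firstEdge : ∀ f → ∑[ p ∈ rest ] when (does (e ≟ f) ∧ isPrefix p' p) (g (f ∷ p))
                      ≈ when (does (f ≟ e)) (∑[ p ∈ rest ] when (isPrefix p' p) (g (f ∷ p)))
    firstEdge f = trans
      (∑-cong rest (λ p → reflexive (≡.trans (when-∧ (does (e ≟ f)) (isPrefix p' p) _)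
                                             (≡.cong (λ c → when c _) (≟-sym _≟_ e f)))))
      (∑-when rest (does (f ≟ e)) _)

  sumOver-≈-∑-listsOfLength : ∀ P f k → (∀ p → P p ≡ true → isPath p ≡ true × length p ≡ k) →
                              sumOver P f ≈ ∑[ p ∈ listsOfLength k ] when (P p) (f p)
  sumOver-≈-∑-listsOfLength P f k P⇒path = begin-equality
    sumOver P f
      ≈⟨ ∑-filter (λ p → P p ≟ᵇ true) candidates f ⟩
    ∑[ p ∈ candidates ] when (does (P p ≟ᵇ true)) (f p)
      ≈⟨ ∑-cong candidates (λ p → reflexive (≡.cong (λ b → when b (f p)) (does-≟ᵇ-true (P p)))) ⟩
    ∑[ p ∈ candidates ] when (P p) (f p)
      ≈⟨ ∑-concatMap (upTo (suc n)) listsOfLength _ ⟩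
    ∑[ j ∈ upTo (suc n) ] slice j
      ≈⟨ slices ⟩
    slice k ∎
    where
    slice : ℕ → Carrier
    slice j = ∑[ p ∈ listsOfLength j ] when (P p) (f p)
    slice-zero : ∀ j → ¬ (j ≡ k × j ℕ.< n) → slice j ≈ 0#
    slice-zero j ¬j≡k<n = ∑-zero (All.map zeroAt (listsOfLength-length j))
      where
      zeroAt : ∀ {p} → length p ≡ j → when (P p) (f p) ≈ 0#
      zeroAt {p} length≡j with P p in Pp
      ... | false = ≈-refl
      ... | true with path , length≡k ← P⇒path p Pp =
        ⊥-elim (¬j≡k<n ( ≡.trans (≡.sym length≡j) length≡k
                        , ≡.subst (ℕ._< n) length≡j (walk-length< root p (path⇒walk p path))))
    slices : ∑[ j ∈ upTo (suc n) ] slice j ≈ slice k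
    slices with k ℕ.<? suc n
    ... | yes k≤n = ∑-single (upTo⁺ (suc n)) (∈-upTo⁺ k≤n) (λ j j≢k → slice-zero j (j≢k ∘ proj₁))
    ... | no k>n  = trans (∑-zero {xs = upTo (suc n)} (All.tabulate (λ {j} _ → slice-zero j out)))
                          (sym (slice-zero k out))
      where
      out : ∀ {j} → ¬ (j ≡ k × j ℕ.< n)
      out (refl , k<n) = k>n (ℕₚ.m<n⇒m<1+n k<n)

module SheraliAdamsBounds (R : OrderedCommRing) {ℓ : ℕ} (G : LayeredDST ℓ)
  (y : Subset (LayeredDST.m G) → OrderedCommRing.Carrier R) (sa : DST.SAFeasible R G y) where
  open OrderedCommRing R renaming (refl to ≈-refl)
  open OrderedCommRingProperties R
  open LayeredDST G
  open DST R G
  open LayeredWalks R G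
  open SAFeasible sa
  open import Algebra.Properties.Ring ring using (-‿distribˡ-*; -‿+-comm; -0#≈0#)

  monomialTimes : Subset m → Carrier × Subset m → Carrier
  monomialTimes S (b , T) = b * y (T ∪ S)

  -- linearization of g · ∏_{e ∈ S} y_e
  linearizeTimes : Subset m → Poly → Carrier
  linearizeTimes S g = ∑ g (monomialTimes S)

  linearize-⊗-monomial : ∀ g {a} S → a ≈ 1# → linearize y (g ⊗ ((a , S) ∷ [])) ≈ linearizeTimes S g
  linearize-⊗-monomial []            S a≈1 = ≈-refl
  linearize-⊗-monomial ((b , T) ∷ g) S a≈1 =
    +-cong (*-congʳ (trans (*-congˡ a≈1) (*-identityʳ b))) (linearize-⊗-monomial g S a≈1)

  selectedEdges : Subset m → List Edge → Subset m
  selectedEdges S []       = ∅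
  selectedEdges S (e ∷ es) = (if does (e ∈? S) then ⁅ e ⁆ else ∅) ∪ selectedEdges S es

  selectedEdges-⊆ : ∀ S es → selectedEdges S es ⊆ S
  selectedEdges-⊆ S []       x∈∅ = ⊥-elim (∉⊥ x∈∅)
  selectedEdges-⊆ S (e ∷ es) {x} x∈ with e ∈? S | x∈p∪q⁻ _ (selectedEdges S es) x∈
  ... | yes e∈S | inj₁ x∈⁅e⁆ rewrite x∈⁅y⁆⇒x≡y e x∈⁅e⁆ = e∈S
  ... | no  _   | inj₁ x∈∅   = ⊥-elim (∉⊥ x∈∅)
  ... | _       | inj₂ x∈es  = selectedEdges-⊆ S es x∈es

  ⊆-selectedEdges : ∀ S es {x} → x ∈ es → x ∈ₛ S → x ∈ₛ selectedEdges S es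
  ⊆-selectedEdges S (e ∷ es) (here refl) x∈S with e ∈? S
  ... | yes _   = x∈p∪q⁺ (inj₁ (x∈⁅x⁆ e))
  ... | no  e∉S = ⊥-elim (e∉S x∈S)
  ⊆-selectedEdges S (e ∷ es) (there x∈es) x∈S = x∈p∪q⁺ (inj₂ (⊆-selectedEdges S es x∈es x∈S))

  selectedEdges-allEdges : ∀ S → selectedEdges S allEdges ≡ S
  selectedEdges-allEdges S =
    ⊆-antisym (selectedEdges-⊆ S allEdges) (⊆-selectedEdges S allEdges (∈-allFin _))

  -- Definitionally the factor at e of `multiplier S ∅`.
  multiplierFactor : Subset m → Edge → Poly
  multiplierFactor S e = if does (e ∈? S) then var e
                         else if does (e ∈? ∅) then (const 1# ⊝ var e)
                         else const 1#

  multiplierFactors-monomial : ∀ S es → Σ[ a ∈ Carrier ]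
    (a ≈ 1# × ΠP (map (multiplierFactor S) es) ≡ (a , selectedEdges S es) ∷ [])
  multiplierFactors-monomial S []       = 1# , ≈-refl , refl
  multiplierFactors-monomial S (e ∷ es)
    with a , a≈1 , product ← multiplierFactors-monomial S es rewrite product with does (e ∈? S)
  ... | true = 1# * a , trans (*-identityˡ a) a≈1 , refl
  ... | false with e ∈? ∅
  ...   | yes e∈∅ = ⊥-elim (∉⊥ e∈∅)
  ...   | no  _   = 1# * a , trans (*-identityˡ a) a≈1 , refl

  multiplier-monomial : ∀ S → Σ[ a ∈ Carrier ] (a ≈ 1# × multiplier S ∅ ≡ (a , S) ∷ [])
  multiplier-monomial S with a , a≈1 , product ← multiplierFactors-monomial S allEdges =
    a , a≈1 , ≡.trans product (≡.cong (λ T → (a , T) ∷ []) (selectedEdges-allEdges S))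

  lifted-product : ∀ {g} → LP2Constraint g → ∀ S → ∣ S ∣ ℕ.≤ ℓ → 0# ≤ linearizeTimes S g
  lifted-product {g} constraint S |S|≤ℓ with a , a≈1 , mult≡ ← multiplier-monomial S = begin
    0#                                ≤⟨ ≡.subst (λ M → 0# ≤ linearize y (g ⊗ M)) mult≡ liftedBySubset ⟩
    linearize y (g ⊗ ((a , S) ∷ []))  ≈⟨ linearize-⊗-monomial g S a≈1 ⟩
    linearizeTimes S g                ∎
    where
    liftedBySubset : 0# ≤ linearize y (g ⊗ multiplier S ∅)
    liftedBySubset = lifted g constraint S ∅ (∩-zeroʳ S)
      (≡.subst (ℕ._≤ ℓ) (≡.cong ∣_∣ (≡.sym (∪-identityʳ S))) |S|≤ℓ)

  linearizeTimes-⊖ : ∀ g S → linearizeTimes S (⊖ g) ≈ - linearizeTimes S g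
  linearizeTimes-⊖ []            S = sym -0#≈0#
  linearizeTimes-⊖ ((b , T) ∷ g) S = begin-equality
    - b * y (T ∪ S) + linearizeTimes S (⊖ g)  ≈⟨ +-cong (sym (-‿distribˡ-* b _)) (linearizeTimes-⊖ g S) ⟩
    - (b * y (T ∪ S)) + - linearizeTimes S g  ≈⟨ -‿+-comm _ _ ⟩
    - (b * y (T ∪ S) + linearizeTimes S g)    ∎

  linearizeTimes-⊝ : ∀ g h S → linearizeTimes S (g ⊝ h) ≈ linearizeTimes S g + - linearizeTimes S h
  linearizeTimes-⊝ g h S = trans (∑-++ g (⊖ h) (monomialTimes S)) (+-congˡ (linearizeTimes-⊖ h S))

  linearizeTimes-one : ∀ S → linearizeTimes S (const 1#) ≈ y S
  linearizeTimes-one S =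
    trans (+-identityʳ _) (trans (*-identityˡ _) (reflexive (≡.cong y (∪-identityˡ S))))

  linearizeTimes-var : ∀ e S → linearizeTimes S (var e) ≈ y (⁅ e ⁆ ∪ S)
  linearizeTimes-var e S = trans (+-identityʳ _) (*-identityˡ _)

  inflow : Subset m → Fin n → Carrier
  inflow S v = ∑[ e ∈ allEdges ] when (does (head e ≟ v)) (y (⁅ e ⁆ ∪ S))

  linearizeTimes-inSum : ∀ v S → linearizeTimes S (inSum v) ≈ inflow S v
  linearizeTimes-inSum v S = trans (sumVars (δin v)) (∑-filter (λ e → head e ≟ v) allEdges _)
    where
    sumVars : ∀ es → linearizeTimes S (ΣP (map var es)) ≈ ∑[ e ∈ es ] y (⁅ e ⁆ ∪ S)
    sumVars []       = ≈-refl
    sumVars (e ∷ es) = +-cong (*-identityˡ _) (sumVars es)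

  lifted-≤ : ∀ g h {S a b} → LP2Constraint (g ⊝ h) → ∣ S ∣ ℕ.≤ ℓ →
             linearizeTimes S g ≈ a → linearizeTimes S h ≈ b → b ≤ a
  lifted-≤ g h {S} {a} {b} constraint |S|≤ℓ g≈a h≈b = nonneg-diff⇒≤ (begin
    0#                                         ≤⟨ lifted-product constraint S |S|≤ℓ ⟩
    linearizeTimes S (g ⊝ h)                   ≈⟨ linearizeTimes-⊝ g h S ⟩
    linearizeTimes S g + - linearizeTimes S h  ≈⟨ +-cong g≈a (-‿cong h≈b) ⟩
    a + - b                                    ∎)

  inflow-≤ : ∀ {v S} → v ≢ root → ∣ S ∣ ℕ.≤ ℓ → inflow S v ≤ y S
  inflow-≤ {v} {S} v≢root |S|≤ℓ =
    lifted-≤ (const 1#) (inSum v) (indeg v v≢root) |S|≤ℓ (linearizeTimes-one S) (linearizeTimes-inSum v S)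

  outEdge-≤-inflow : ∀ {v f S} → v ≢ root → tail f ≡ v → ∣ S ∣ ℕ.≤ ℓ → y (⁅ f ⁆ ∪ S) ≤ inflow S v
  outEdge-≤-inflow {v} {f} {S} v≢root tail≡v |S|≤ℓ =
    lifted-≤ (inSum v) (var f) (flow v f v≢root tail≡v) |S|≤ℓ (linearizeTimes-inSum v S) (linearizeTimes-var f S)

  terminal-≤-inflow : ∀ {t S} → Terminal t → ∣ S ∣ ℕ.≤ ℓ → y S ≤ inflow S t
  terminal-≤-inflow {t} {S} terminal |S|≤ℓ =
    lifted-≤ (inSum t) (const 1#) (cover t terminal) |S|≤ℓ (linearizeTimes-inSum t S) (linearizeTimes-one S)

  -- The two situations in which the lifted LP2 constraints give y_S ≤ ∑_{e ∈ δin(u)} y_{S ∪ {e}}.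
  Demanded : Fin n → Subset m → Set
  Demanded u S = Terminal u ⊎ Σ[ f ∈ Edge ] (tail f ≡ u × ⁅ f ⁆ ∪ S ≡ S)

  demanded-≤-inflow : ∀ {u S} → u ≢ root → ∣ S ∣ ℕ.≤ ℓ → Demanded u S → y S ≤ inflow S u
  demanded-≤-inflow u≢root |S|≤ℓ (inj₁ terminal) = terminal-≤-inflow terminal |S|≤ℓ
  demanded-≤-inflow {u} {S} u≢root |S|≤ℓ (inj₂ (f , tail≡u , f∈S)) =
    ≡.subst (λ T → y T ≤ inflow S u) f∈S (outEdge-≤-inflow u≢root tail≡u |S|≤ℓ)

  y-≤-walkSum : ∀ k u S → layer u ≡ k → ∣ S ∣ ℕ.+ k ℕ.≤ ℓ → Demanded u S →
                y S ≤ walkSum root u k (λ w → y (S ∪ edgeSet w))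
  y-≤-walkSum zero u S layer0 _ _ with refl ← layer0⇒root u layer0 = begin
    y S                                            ≈⟨ reflexive (≡.cong y (∪-identityʳ S)) ⟨
    y (S ∪ ∅)
      ≡⟨ ≡.cong (λ b → when b (y (S ∪ ∅))) (dec-true (root ≟ root) refl) ⟨
    when (does (root ≟ root)) (y (S ∪ ∅))          ≈⟨ walkSum-zero root root (λ w → y (S ∪ edgeSet w)) ⟨
    walkSum root root 0 (λ w → y (S ∪ edgeSet w))  ∎
  y-≤-walkSum (suc k) u S layer≡ size demanded = begin
    y S
      ≤⟨ demanded-≤-inflow (layer≡suc⇒≢root layer≡) (ℕₚ.m+n≤o⇒m≤o ∣ S ∣ size) demanded ⟩
    inflow S u
      ≤⟨ ∑-mono-≤ allEdges extend ⟩
    ∑[ e ∈ allEdges ] when (does (head e ≟ u)) (walkSum root (tail e) k (λ w → y (S ∪ edgeSet (w ++ [ e ]))))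
      ≈⟨ walkSum-suc root u k _ ⟨
    walkSum root u (suc k) (λ w → y (S ∪ edgeSet w)) ∎
    where
    extend : ∀ e → when (does (head e ≟ u)) (y (⁅ e ⁆ ∪ S))
                   ≤ when (does (head e ≟ u)) (walkSum root (tail e) k (λ w → y (S ∪ edgeSet (w ++ [ e ]))))
    extend e = when-dec-mono (head e ≟ u) λ head≡u → begin
      y (⁅ e ⁆ ∪ S)
        ≤⟨ y-≤-walkSum k (tail e) (⁅ e ⁆ ∪ S) (layer-tail e (≡.trans (≡.cong layer head≡u) layer≡))
             (ℕₚ.≤-trans (∣⁅x⁆∪p∣+k≤∣p∣+1+k e S k) size) (inj₂ (e , refl , ∪-idemˡ ⁅ e ⁆ S)) ⟩
      walkSum root (tail e) k (λ w → y ((⁅ e ⁆ ∪ S) ∪ edgeSet w))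
        ≈⟨ walkSum-cong root (tail e) k (λ w → reflexive (≡.cong y (∪-edgeSet-∷ʳ S w e))) ⟨
      walkSum root (tail e) k (λ w → y (S ∪ edgeSet (w ++ [ e ]))) ∎

  walkSum-≤-y : ∀ k v u S → k ℕ.+ layer v ≡ layer u → ∣ S ∣ ℕ.+ k ℕ.≤ ℓ →
                walkSum v u k (λ w → y (S ∪ edgeSet w)) ≤ y S
  walkSum-≤-y zero v u S _ size = begin
    walkSum v u 0 (λ w → y (S ∪ edgeSet w))  ≈⟨ walkSum-zero v u (λ w → y (S ∪ edgeSet w)) ⟩
    when (does (v ≟ u)) (y (S ∪ ∅))
      ≤⟨ when-≤ (does (v ≟ u)) 0≤yS (≤-reflexive (reflexive (≡.cong y (∪-identityʳ S)))) ⟩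
    y S                                      ∎
    where
    0≤yS : 0# ≤ y S
    0≤yS = y-nonneg S (ℕₚ.m≤n⇒m≤1+n (ℕₚ.m+n≤o⇒m≤o ∣ S ∣ size))
  walkSum-≤-y (suc k) v u S layers size = begin
    walkSum v u (suc k) (λ w → y (S ∪ edgeSet w))
      ≈⟨ walkSum-suc v u k _ ⟩
    ∑[ e ∈ allEdges ] when (does (head e ≟ u)) (walkSum v (tail e) k (λ w → y (S ∪ edgeSet (w ++ [ e ]))))
      ≤⟨ ∑-mono-≤ allEdges retract ⟩
    inflow S u
      ≤⟨ inflow-≤ (layer≡suc⇒≢root (≡.sym layers)) (ℕₚ.m+n≤o⇒m≤o ∣ S ∣ size) ⟩
    y S ∎
    where
    retract : ∀ e → when (does (head e ≟ u)) (walkSum v (tail e) k (λ w → y (S ∪ edgeSet (w ++ [ e ]))))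
                    ≤ when (does (head e ≟ u)) (y (⁅ e ⁆ ∪ S))
    retract e = when-dec-mono (head e ≟ u) λ head≡u → begin
      walkSum v (tail e) k (λ w → y (S ∪ edgeSet (w ++ [ e ])))
        ≈⟨ walkSum-cong v (tail e) k (λ w → reflexive (≡.cong y (∪-edgeSet-∷ʳ S w e))) ⟩
      walkSum v (tail e) k (λ w → y ((⁅ e ⁆ ∪ S) ∪ edgeSet w))
        ≤⟨ walkSum-≤-y k v (tail e) (⁅ e ⁆ ∪ S)
             (≡.sym (layer-tail e (≡.trans (≡.cong layer head≡u) (≡.sym layers))))
             (ℕₚ.≤-trans (∣⁅x⁆∪p∣+k≤∣p∣+1+k e S k) size) ⟩
      y (⁅ e ⁆ ∪ S) ∎

  path-nonneg : ∀ p → isPath p ≡ true → 0# ≤ xStar y p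
  path-nonneg p path = y-nonneg (edgeSet p)
    (ℕₚ.m≤n⇒m≤1+n (ℕₚ.≤-trans (∣edgeSet∣≤length p) (path-length≤ℓ p path)))

  paths-cover : ∀ t → Terminal t → 1# ≤ sumOver (isPathTo t) (xStar y)
  paths-cover t terminal = begin
    1#
      ≈⟨ y∅ ⟨
    y ∅
      ≤⟨ y-≤-walkSum ℓ t ∅ terminal (ℕₚ.≤-reflexive (≡.cong (ℕ._+ ℓ) (∣⊥∣≡0 m))) (inj₁ terminal) ⟩
    walkSum root t ℓ (λ p → y (∅ ∪ edgeSet p))
      ≈⟨ ∑-cong (listsOfLength ℓ) (λ p → reflexive
           (≡.cong₂ when (≡.sym (isPathTo≡isWalkFromTo t p)) (≡.cong y (∪-identityˡ (edgeSet p))))) ⟩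
    ∑[ p ∈ listsOfLength ℓ ] when (isPathTo t p) (xStar y p)
      ≈⟨ sumOver-≈-∑-listsOfLength (isPathTo t) (xStar y) ℓ pathTo⇒length≡ℓ ⟨
    sumOver (isPathTo t) (xStar y) ∎
    where
    pathTo⇒length≡ℓ : ∀ p → isPathTo t p ≡ true → isPath p ≡ true × length p ≡ ℓ
    pathTo⇒length≡ℓ p pathTo with path , length≡ ← pathTo-length t p pathTo = path , ≡.trans length≡ terminal

  paths-through-prefix : ∀ t → Terminal t → ∀ p' → isPath p' ≡ true →
                         sumOver (λ p → isPathTo t p ∧ isPrefix p' p) (xStar y) ≤ xStar y p'
  paths-through-prefix t terminal p' path' = begin
    sumOver (λ p → isPathTo t p ∧ isPrefix p' p) (xStar y)
      ≈⟨ sumOver-≈-∑-listsOfLength _ (xStar y) ℓ pathTo⇒length≡ℓ ⟩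
    ∑[ p ∈ listsOfLength ℓ ] when (isPathTo t p ∧ isPrefix p' p) (y (edgeSet p))
      ≡⟨ ≡.cong (λ k → ∑[ p ∈ listsOfLength k ] when (isPathTo t p ∧ isPrefix p' p) (y (edgeSet p))) a+b≡ℓ ⟨
    ∑[ p ∈ listsOfLength (a ℕ.+ b) ] when (isPathTo t p ∧ isPrefix p' p) (y (edgeSet p))
      ≈⟨ ∑-cong (listsOfLength (a ℕ.+ b)) (λ p → reflexive
           (≡.trans (when-∧ (isPathTo t p) (isPrefix p' p) _) (when-comm (isPathTo t p) (isPrefix p' p) _))) ⟩
    ∑[ p ∈ listsOfLength (a ℕ.+ b) ] when (isPrefix p' p) (when (isPathTo t p) (y (edgeSet p)))
      ≈⟨ ∑-isPrefix p' b _ ⟩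
    ∑[ q ∈ listsOfLength b ] when (isPathTo t (p' ++ q)) (y (edgeSet (p' ++ q)))
      ≈⟨ ∑-cong (listsOfLength b) (λ q → reflexive (≡.cong₂ when (continuation q) (≡.cong y (edgeSet-++ p' q)))) ⟩
    walkSum (endpoint root p') t b (λ q → y (edgeSet p' ∪ edgeSet q))
      ≤⟨ walkSum-≤-y b (endpoint root p') t (edgeSet p') layers size ⟩
    y (edgeSet p') ∎
    where
    walk' : isWalkFrom root p' ≡ true
    walk' = path⇒walk p' path'
    a b : ℕ
    a = length p'
    b = ℓ ℕ.∸ a
    a+b≡ℓ : a ℕ.+ b ≡ ℓ
    a+b≡ℓ = ℕₚ.m+[n∸m]≡n (path-length≤ℓ p' path')
    pathTo⇒length≡ℓ : ∀ p → isPathTo t p ∧ isPrefix p' p ≡ true → isPath p ≡ true × length p ≡ ℓ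
    pathTo⇒length≡ℓ p through with path , length≡ ← pathTo-length t p (proj₁ (∧-true⁻ through)) =
      path , ≡.trans length≡ terminal
    continuation : ∀ q → isPathTo t (p' ++ q) ≡ isWalkFromTo (endpoint root p') t q
    continuation q = ≡.trans (isPathTo≡isWalkFromTo t (p' ++ q)) (isWalkFromTo-++ root t p' q walk')
    layers : b ℕ.+ layer (endpoint root p') ≡ layer t
    layers = ≡.trans (≡.cong (b ℕ.+_) (layer-endpoint-root p' walk'))
                     (≡.trans (ℕₚ.+-comm b a) (≡.trans a+b≡ℓ (≡.sym terminal)))
    size : ∣ edgeSet p' ∣ ℕ.+ b ℕ.≤ ℓ
    size = ℕₚ.≤-trans (ℕₚ.+-monoˡ-≤ b (∣edgeSet∣≤length p')) (ℕₚ.≤-reflexive a+b≡ℓ)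

  paths-ending-in-≤ : ∀ e → sumOver (isPathLast e) (xStar y) ≤ y ⁅ e ⁆
  paths-ending-in-≤ e = begin
    sumOver (isPathLast e) (xStar y)
      ≈⟨ sumOver-≈-∑-listsOfLength (isPathLast e) (xStar y) (suc k) (pathLast-length e) ⟩
    ∑[ p ∈ listsOfLength (suc k) ] when (isPathLast e p) (y (edgeSet p))
      ≈⟨ ∑-listsOfLength-∷ʳ k _ ⟩
    ∑[ w ∈ listsOfLength k ] ∑[ f ∈ allEdges ] when (isPathLast e (w ++ [ f ])) (y (edgeSet (w ++ [ f ])))
      ≈⟨ ∑-cong (listsOfLength k) lastEdge ⟩
    walkSum root (tail e) k (λ w → y (⁅ e ⁆ ∪ edgeSet w))
      ≤⟨ walkSum-≤-y k root (tail e) ⁅ e ⁆ layers size ⟩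
    y ⁅ e ⁆ ∎
    where
    k : ℕ
    k = layer (tail e)
    lastEdge : ∀ w → ∑[ f ∈ allEdges ] when (isPathLast e (w ++ [ f ])) (y (edgeSet (w ++ [ f ])))
                     ≈ when (isWalkFromTo root (tail e) w) (y (⁅ e ⁆ ∪ edgeSet w))
    lastEdge w = begin-equality
      ∑[ f ∈ allEdges ] when (isPathLast e (w ++ [ f ])) (y (edgeSet (w ++ [ f ])))
        ≈⟨ ∑-cong allEdges (λ f → reflexive (guard f)) ⟩
      ∑[ f ∈ allEdges ] when (does (f ≟ e)) (when (isWalkFromTo root (tail f) w) (y (edgeSet (w ++ [ f ]))))
        ≈⟨ ∑-when-≡ _≟_ (λ f → when (isWalkFromTo root (tail f) w) (y (edgeSet (w ++ [ f ]))))
                    (allFin⁺ m) (∈-allFin e) ⟩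
      when (isWalkFromTo root (tail e) w) (y (edgeSet (w ++ [ e ])))
        ≡⟨ ≡.cong (when (isWalkFromTo root (tail e) w) ∘ y) (edgeSet-∷ʳ w e) ⟩
      when (isWalkFromTo root (tail e) w) (y (⁅ e ⁆ ∪ edgeSet w)) ∎
      where
      guard : ∀ f → when (isPathLast e (w ++ [ f ])) (y (edgeSet (w ++ [ f ])))
                    ≡ when (does (f ≟ e)) (when (isWalkFromTo root (tail f) w) (y (edgeSet (w ++ [ f ]))))
      guard f = ≡.trans
        (≡.cong (λ b → when b (y (edgeSet (w ++ [ f ]))))
          (≡.cong₂ _∧_ (≡.trans (isPath≡isWalkFrom (w ++ [ f ])) (isWalkFrom-∷ʳ root w f)) (lastIs-∷ʳ e w f)))
        (≡.trans (when-∧ (isWalkFromTo root (tail f) w) (does (f ≟ e)) _)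
                 (when-comm (isWalkFromTo root (tail f) w) (does (f ≟ e)) _))
    layers : k ℕ.+ layer root ≡ layer (tail e)
    layers = ≡.trans (≡.cong (k ℕ.+_) root-layer0) (ℕₚ.+-identityʳ k)
    size : ∣ ⁅ e ⁆ ∣ ℕ.+ k ℕ.≤ ℓ
    size = ≡.subst (ℕ._≤ ℓ) (≡.trans (edge-layer e) (≡.cong (ℕ._+ k) (≡.sym (∣⁅x⁆∣≡1 e)))) (layer≤ℓ (head e))

  objective-≤ : (c : Edge → Carrier) → (∀ e → 0# ≤ c e) → objLP1 c (xStar y) ≤ objLP2 c y
  objective-≤ c 0≤c = ∑-mono-≤ allEdges λ e → ≤-respˡ-≈ (sym (∑-*ˡ (paths e) (c e) (xStar y)))
    (*-monoˡ-≤-nonNeg (0≤c e) (paths-ending-in-≤ e))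
    where
    paths : Edge → List (List Edge)
    paths e = filter (λ p → isPathLast e p ≟ᵇ true) candidates

mainTheorem2 : (R : OrderedCommRing) (ℓ : ℕ) (G : LayeredDST ℓ)
  → let open OrderedCommRing R
        open LayeredDST G
        open DST R G
    in (c : Fin m → Carrier) → (∀ e → 0# ≤ c e)
  → (y : Subset m → Carrier) → SAFeasible y
  → LP1Feasible (xStar y) × (objLP1 c (xStar y) ≤ objLP2 c y)
mainTheorem2 R ℓ G c 0≤c y sa =
  record { cover1 = paths-cover ; prefix1 = paths-through-prefix ; nonneg1 = path-nonneg } ,
  objective-≤ c 0≤c
  where open SheraliAdamsBounds R G y sa
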